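{- If a graph $G$ is $k$-colourable with clustering $c$ and $P$ is a path, then $G\boxtimes P$ is $(k+1)$-colourable with clustering $ck$.
   Context: $\boxtimes$ is the strong product (vertex set $V(A)\times V(B)$; distinct $(v,x),(w,y)$ adjacent iff ($v=w$, $xy\in E(B)$) or ($x=y$, $vw\in E(A)$) or ($vw\in E(A)$, $xy\in E(B)$)). A $k$-colouring is a map from vertices to a set of $k$ colours; it has clustering $c$ if every connected component of the subgraph induced by each colour class has at most $c$ vertices. -}

module Defs where

open import Data.Nat using (ℕ; suc)
open import Data.Fin using (Fin; toℕ; zero)
open import Data.Product using (_×_; _,_; Σ)
open import Data.Sum using (_⊎_)
open import Data.Empty using (⊥)
open import Relation.Binary.PropositionalEquality using (_≡_)
open import Relation.Nullary using (¬_)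

record Graph (V : Set) : Set₁ where
  field
    Adj    : V → V → Set
    sym    : ∀ {u v} → Adj u v → Adj v u
    irrefl : ∀ {u} → ¬ Adj u u
open Graph public

_⊠_ : ∀ {V W} → Graph V → Graph W → Graph (V × W)
Adj (_⊠_ A B) (v , x) (w , y) =
  ((v ≡ w) × Adj B x y) ⊎ (((x ≡ y) × Adj A v w) ⊎ (Adj A v w × Adj B x y))
sym (_⊠_ A B) (Data.Sum.inj₁ (Relation.Binary.PropositionalEquality.refl , b)) =
  Data.Sum.inj₁ (Relation.Binary.PropositionalEquality.refl , sym B b)
sym (_⊠_ A B) (Data.Sum.inj₂ (Data.Sum.inj₁ (Relation.Binary.PropositionalEquality.refl , a))) =
  Data.Sum.inj₂ (Data.Sum.inj₁ (Relation.Binary.PropositionalEquality.refl , sym A a))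
sym (_⊠_ A B) (Data.Sum.inj₂ (Data.Sum.inj₂ (a , b))) =
  Data.Sum.inj₂ (Data.Sum.inj₂ (sym A a , sym B b))
irrefl (_⊠_ A B) (Data.Sum.inj₁ (_ , b)) = irrefl B b
irrefl (_⊠_ A B) (Data.Sum.inj₂ (Data.Sum.inj₁ (_ , a))) = irrefl A a
irrefl (_⊠_ A B) (Data.Sum.inj₂ (Data.Sum.inj₂ (a , _))) = irrefl A a

Path : (m : ℕ) → Graph (Fin m)
Adj (Path m) i j = (suc (toℕ i) ≡ toℕ j) ⊎ (suc (toℕ j) ≡ toℕ i)
sym (Path m) (Data.Sum.inj₁ e) = Data.Sum.inj₂ e
sym (Path m) (Data.Sum.inj₂ e) = Data.Sum.inj₁ e
irrefl (Path m) {i} (Data.Sum.inj₁ e) = lem (toℕ i) e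
  where
  lem : ∀ n → suc n ≡ n → ⊥
  lem (suc n) e' with e'
  ... | ()
irrefl (Path m) {i} (Data.Sum.inj₂ e) = lem (toℕ i) e
  where
  lem : ∀ n → suc n ≡ n → ⊥
  lem (suc n) e' with e'
  ... | ()

-- u and v lie in the same connected component of the subgraph induced by the
-- colour class of u under the colouring f (a walk all of whose vertices have
-- the colour of u).
data MonoReach {V : Set} (G : Graph V) {C : Set} (f : V → C) : V → V → Set where
  here : ∀ {u} → MonoReach G f u u
  step : ∀ {u w v} → Adj G u w → f u ≡ f w → MonoReach G f w v → MonoReach G f u v

-- f has clustering c: every monochromatic component has at most c vertices,
-- i.e. no c+1 pairwise distinct vertices lie in a common monochromatic component.
HasClustering : {V : Set} → (G : Graph V) → {C : Set} → (V → C) → ℕ → Set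
HasClustering {V} G f c =
  ∀ (u : V) (g : Fin (suc c) → V) →
    (∀ i j → g i ≡ g j → i ≡ j) →
    (∀ i → MonoReach G f u (g i)) → ⊥

ColourableWithClustering : {V : Set} → Graph V → ℕ → ℕ → Set
ColourableWithClustering {V} G k c = Σ (V → Fin k) λ f → HasClustering G f c

-- Colour layer l of G ⊠ P so that G-colour class j gets colour D(l, j) mod (k+1),
-- where the "deadline" D(l, j) is the least number ≥ l congruent to j mod k.
-- Two such deadlines in adjacent layers lie in a window of k+1 consecutive numbers,
-- so equal colours force equal deadlines, hence equal G-colours.  A monochromatic
-- component therefore projects into a monochromatic component of G and has a single
-- deadline D, so it meets only the k layers D-k < l ≤ D; by pigeonhole, c·k+1 of its
-- vertices would put c+1 distinct vertices of one G-component into one layer.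
module Submission where

open import Defs hiding (sym)
open import Data.Nat using (ℕ; zero; suc; _+_; _*_; _%_; _/_; _≤_; _<_; NonZero)
open import Data.Nat.Properties
  using ( ≤-refl; ≤-reflexive; ≤-trans; ≤-antisym; ≤-total; ≤-pred; ≮⇒≥; <⇒≱; <-≤-trans
        ; n≮0; m≤m+n; n≤1+n; +-suc; *-suc; +-assoc; +-comm; +-cancelʳ-≡
        ; +-mono-≤; +-monoˡ-≤; +-monoʳ-≤; +-monoʳ-<; *-monoˡ-≤; module ≤-Reasoning)
open import Data.Nat.DivMod using (m≡m%n+[m/n]*n; m%n<n; m<n⇒m%n≡m; [m+n]%n≡m%n; /-monoˡ-≤)
open import Data.Fin using (Fin; zero; suc; toℕ; fromℕ; fromℕ<; inject₁)
open import Data.Fin.Properties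
  using (¬Fin0; suc-injective; toℕ<n; toℕ-injective; toℕ-inject₁; toℕ-fromℕ; fromℕ<-injective)
open import Data.Product using (Σ; _×_; _,_; proj₁; proj₂)
open import Data.Product.Properties using (×-≡,≡→≡)
open import Data.Sum using (_⊎_; inj₁; inj₂)
import Data.Sum as Sum
open import Data.Empty using (⊥-elim)
open import Function using (_∘_)
open import Relation.Unary using (Pred)
open import Relation.Binary.PropositionalEquality
  using (_≡_; refl; sym; trans; cong; cong₂; subst; module ≡-Reasoning)

record Distinct {A : Set} (P : Pred A _) (n : ℕ) : Set where
  field
    elem           : Fin n → A
    elem-injective : ∀ i j → elem i ≡ elem j → i ≡ j
    elem-sat       : ∀ i → P (elem i)
open Distinct

distinct-singleton : ∀ {A} {P : Pred A _} {x} → P x → Distinct P 1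
distinct-singleton {x = x} p = record
  { elem = λ _ → x ; elem-injective = λ { zero zero _ → refl } ; elem-sat = λ _ → p }

distinct-map : ∀ {A B n} {P : Pred A _} {Q : Pred B _} (h : A → B) →
  (∀ x y → h x ≡ h y → x ≡ y) → (∀ x → P x → Q (h x)) → Distinct P n → Distinct Q n
distinct-map h h-inj PQ D = record
  { elem = h ∘ elem D
  ; elem-injective = λ i j e → elem-injective D i j (h-inj _ _ e)
  ; elem-sat = λ i → PQ _ (elem-sat D i) }

distinct-cons : ∀ {N n} {P : Pred (Fin (suc N)) _} →
  P zero → Distinct (P ∘ suc) n → Distinct P (suc n)
distinct-cons {P = P} p D = record { elem = elem′ ; elem-injective = inj ; elem-sat = sat }
  where
  elem′ : Fin _ → Fin _
  elem′ zero    = zero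
  elem′ (suc i) = suc (elem D i)
  inj : ∀ i j → elem′ i ≡ elem′ j → i ≡ j
  inj zero    zero    _ = refl
  inj zero    (suc _) ()
  inj (suc _) zero    ()
  inj (suc i) (suc j) e = cong suc (elem-injective D i j (suc-injective e))
  sat : ∀ i → P (elem′ i)
  sat zero    = p
  sat (suc i) = elem-sat D i

distinct-shift : ∀ {N n} {P : Pred (Fin (suc N)) _} → Distinct (P ∘ suc) n → Distinct P n
distinct-shift = distinct-map suc (λ _ _ → suc-injective) (λ _ p → p)

dichotomy : ∀ {N} {P Q : Pred (Fin N) _} → (∀ x → P x ⊎ Q x) →
  ∀ a b → a + b < N → Distinct P (suc a) ⊎ Distinct Q (suc b)
dichotomy {zero} _ _ _ ()
dichotomy {suc N} P⊎Q a b a+b<N with P⊎Q zero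
dichotomy {suc N} P⊎Q zero     b a+b<N | inj₁ p = inj₁ (distinct-singleton p)
dichotomy {suc N} P⊎Q (suc a′) b a+b<N | inj₁ p =
  Sum.map (distinct-cons p) distinct-shift (dichotomy (P⊎Q ∘ suc) a′ b (≤-pred a+b<N))
dichotomy {suc N} P⊎Q a zero     a+b<N | inj₂ q = inj₂ (distinct-singleton q)
dichotomy {suc N} P⊎Q a (suc b′) a+b<N | inj₂ q =
  Sum.map distinct-shift (distinct-cons q)
    (dichotomy (P⊎Q ∘ suc) a b′ (≤-pred (subst (_< suc N) (+-suc a b′) a+b<N)))

pigeonhole : ∀ c k {N} (L : Fin N → Fin k) → c * k < N →
  Σ (Fin k) λ t → Distinct (λ x → L x ≡ t) (suc c)
pigeonhole c zero    {zero}  L lt = ⊥-elim (n≮0 lt)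
pigeonhole c zero    {suc N} L lt = ⊥-elim (¬Fin0 (L zero))
pigeonhole c (suc k) {N}     L lt
  with dichotomy zero⊎suc c (c * k) (subst (_< N) (*-suc c k) lt)
  where
  zero⊎suc : ∀ x → L x ≡ zero ⊎ Σ (Fin k) λ t → L x ≡ suc t
  zero⊎suc x with L x
  ... | zero  = inj₁ refl
  ... | suc t = inj₂ (t , refl)
... | inj₁ D = zero , D
... | inj₂ D with pigeonhole c k (proj₁ ∘ elem-sat D) ≤-refl
...   | t , E = suc t , distinct-map (elem D) (elem-injective D) lift E
  where
  lift : ∀ i → proj₁ (elem-sat D i) ≡ t → L (elem D i) ≡ suc t
  lift i e = trans (proj₂ (elem-sat D i)) (cong suc e)

%-injective-within : ∀ {x y n} .{{_ : NonZero n}} →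
  x ≤ y → y < x + n → x % n ≡ y % n → x ≡ y
%-injective-within {x} {y} {n} x≤y y<x+n x%n≡y%n = let open ≡-Reasoning in begin
  x                 ≡⟨ m≡m%n+[m/n]*n x n ⟩
  x % n + x / n * n ≡⟨ cong₂ _+_ x%n≡y%n (cong (_* n) x/n≡y/n) ⟩
  y % n + y / n * n ≡⟨ m≡m%n+[m/n]*n y n ⟨
  y                 ∎
  where
  x+n≤y : x / n < y / n → x + n ≤ y
  x+n≤y x/n<y/n = begin
    x + n                   ≡⟨ cong (_+ n) (m≡m%n+[m/n]*n x n) ⟩
    x % n + x / n * n + n   ≡⟨ trans (+-assoc (x % n) _ n) (cong (x % n +_) (+-comm _ n)) ⟩
    x % n + suc (x / n) * n ≤⟨ +-mono-≤ (≤-reflexive x%n≡y%n) (*-monoˡ-≤ n x/n<y/n) ⟩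
    y % n + y / n * n       ≡⟨ m≡m%n+[m/n]*n y n ⟨
    y                       ∎
    where open ≤-Reasoning
  x/n≡y/n : x / n ≡ y / n
  x/n≡y/n = ≤-antisym (/-monoˡ-≤ n x≤y) (≮⇒≥ (λ lt → <⇒≱ y<x+n (x+n≤y lt)))

%-injective-window : ∀ {w x y n} .{{_ : NonZero n}} →
  w ≤ x → x < w + n → w ≤ y → y < w + n → x % n ≡ y % n → x ≡ y
%-injective-window {n = n} w≤x x<w+n w≤y y<w+n x%n≡y%n with ≤-total _ _
... | inj₁ x≤y = %-injective-within x≤y (<-≤-trans y<w+n (+-monoˡ-≤ n w≤x)) x%n≡y%n
... | inj₂ y≤x = sym (%-injective-within y≤x (<-≤-trans x<w+n (+-monoˡ-≤ n w≤y)) (sym x%n≡y%n))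

⊠-adjacent : ∀ {V W} {A : Graph V} {B : Graph W} {v w x y} →
  Adj (A ⊠ B) (v , x) (w , y) → (v ≡ w ⊎ Adj A v w) × (x ≡ y ⊎ Adj B x y)
⊠-adjacent (inj₁ (refl , xy))        = inj₁ refl , inj₂ xy
⊠-adjacent (inj₂ (inj₁ (refl , vw))) = inj₂ vw , inj₁ refl
⊠-adjacent (inj₂ (inj₂ (vw , xy)))   = inj₂ vw , inj₂ xy

cyclicPred : ∀ {n} → Fin n → Fin n
cyclicPred {suc n} zero = fromℕ n
cyclicPred (suc i)      = inject₁ i

suc-toℕ-cyclicPred : ∀ {n} (i : Fin n) →
  suc (toℕ (cyclicPred i)) ≡ toℕ i ⊎ suc (toℕ (cyclicPred i)) ≡ toℕ i + n
suc-toℕ-cyclicPred {suc n} zero = inj₂ (cong suc (toℕ-fromℕ n))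
suc-toℕ-cyclicPred (suc i)      = inj₁ (cong suc (toℕ-inject₁ i))

module Deadline (k : ℕ) .{{_ : NonZero k}} where

  -- offset l j = (j - l) mod k, so deadline l j is the least number ≥ l congruent to j mod k.
  offset : ℕ → Fin k → Fin k
  offset zero    j = j
  offset (suc l) j = cyclicPred (offset l j)

  deadline : ℕ → Fin k → ℕ
  deadline l j = l + toℕ (offset l j)

  deadline-suc : ∀ l j →
    deadline (suc l) j ≡ deadline l j ⊎ deadline (suc l) j ≡ deadline l j + k
  deadline-suc l j = Sum.map (λ e → trans (sym (+-suc l _)) (cong (l +_) e))
    (λ e → trans (sym (+-suc l _)) (trans (cong (l +_) e) (sym (+-assoc l _ k))))
    (suc-toℕ-cyclicPred (offset l j))

  deadline%k : ∀ l j → deadline l j % k ≡ toℕ j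
  deadline%k zero    j = m<n⇒m%n≡m (toℕ<n j)
  deadline%k (suc l) j with deadline-suc l j
  ... | inj₁ e = trans (cong (_% k) e) (deadline%k l j)
  ... | inj₂ e = trans (cong (_% k) e) (trans ([m+n]%n≡m%n (deadline l j) k) (deadline%k l j))

  deadline-injective : ∀ {l l′ j j′} → deadline l j ≡ deadline l′ j′ → j ≡ j′
  deadline-injective {l} {l′} {j} {j′} e =
    toℕ-injective (trans (sym (deadline%k l j)) (trans (cong (_% k) e) (deadline%k l′ j′)))

  deadline-offset-injective : ∀ {l l′ j j′} →
    deadline l j ≡ deadline l′ j′ → offset l j ≡ offset l′ j′ → l ≡ l′
  deadline-offset-injective {l} {l′} e o = +-cancelʳ-≡ (toℕ (offset l _)) l l′
    (trans e (cong (λ i → l′ + toℕ i) (sym o)))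

  colour : ℕ → Fin k → Fin (suc k)
  colour l j = fromℕ< (m%n<n (deadline l j) (suc k))

  colour-nearby : ∀ {l l′ j j′} → l ≤ l′ → l′ ≤ suc l →
    colour l j ≡ colour l′ j′ → deadline l j ≡ deadline l′ j′
  colour-nearby {l} {l′} {j} {j′} l≤l′ l′≤1+l same =
    %-injective-window (m≤m+n l _) d<l+1+k (≤-trans l≤l′ (m≤m+n l′ _)) d′<l+1+k
      (fromℕ<-injective _ _ _ _ same)
    where
    d<l+1+k : deadline l j < l + suc k
    d<l+1+k = <-≤-trans (+-monoʳ-< l (toℕ<n (offset l j))) (+-monoʳ-≤ l (n≤1+n k))
    d′<l+1+k : deadline l′ j′ < l + suc k
    d′<l+1+k = <-≤-trans (+-monoʳ-< l′ (toℕ<n (offset l′ j′)))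
      (≤-trans (+-monoˡ-≤ k l′≤1+l) (≤-reflexive (sym (+-suc l k))))

module LayeredColouring {n} (G : Graph (Fin n)) (m k : ℕ) .{{_ : NonZero k}}
                        (f : Fin n → Fin k) where
  open Deadline k

  layered : Fin n × Fin m → Fin (suc k)
  layered (v , i) = colour (toℕ i) (f v)

  deadlineAt : Fin n × Fin m → ℕ
  deadlineAt (v , i) = deadline (toℕ i) (f v)

  adjacent-deadline : ∀ {v w i i′} → i ≡ i′ ⊎ Adj (Path m) i i′ →
    layered (v , i) ≡ layered (w , i′) → deadlineAt (v , i) ≡ deadlineAt (w , i′)
  adjacent-deadline {v} {w} {i} {i′} (inj₁ refl) =
    colour-nearby {toℕ i} {toℕ i} {f v} {f w} ≤-refl (n≤1+n _)
  adjacent-deadline {v} {w} {i} {i′} (inj₂ (inj₁ e)) =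
    colour-nearby {toℕ i} {toℕ i′} {f v} {f w}
      (≤-trans (n≤1+n _) (≤-reflexive e)) (≤-reflexive (sym e))
  adjacent-deadline {v} {w} {i} {i′} (inj₂ (inj₂ e)) same = sym
    (colour-nearby {toℕ i′} {toℕ i} {f w} {f v}
      (≤-trans (n≤1+n _) (≤-reflexive e)) (≤-reflexive (sym e)) (sym same))

  monochromatic-projection : ∀ {p q} → MonoReach (G ⊠ Path m) layered p q →
    deadlineAt p ≡ deadlineAt q × MonoReach G f (proj₁ p) (proj₁ q)
  monochromatic-projection here = refl , here
  monochromatic-projection (step {v , i} {w , i′} adj same rest)
    with ⊠-adjacent {A = G} {B = Path m} adj | monochromatic-projection rest
  ... | vw , ii′ | d′ , walk = trans d d′ , project vw
    where
    d = adjacent-deadline ii′ same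
    project : v ≡ w ⊎ Adj G v w → MonoReach G f v _
    project (inj₁ refl) = walk
    project (inj₂ vw)   = step vw (deadline-injective {toℕ i} {toℕ i′} d) walk

  layered-clustering : ∀ {c} → HasClustering G f c → HasClustering (G ⊠ Path m) layered (c * k)
  layered-clustering {c} clustered u g g-injective reach
    with pigeonhole c k (λ x → offset (toℕ (proj₂ (g x))) (f (proj₁ (g x)))) ≤-refl
  ... | t , D = clustered (proj₁ u) (proj₁ ∘ g ∘ elem D) projection-injective
                  (proj₂ ∘ monochromatic-projection ∘ reach ∘ elem D)
    where
    sameDeadline : ∀ x y → deadlineAt (g x) ≡ deadlineAt (g y)
    sameDeadline x y = trans (sym (proj₁ (monochromatic-projection (reach x))))
                             (proj₁ (monochromatic-projection (reach y)))
    projection-injective : ∀ x y → proj₁ (g (elem D x)) ≡ proj₁ (g (elem D y)) → x ≡ y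
    projection-injective x y e = elem-injective D x y (g-injective _ _ (×-≡,≡→≡ (e ,
      toℕ-injective (deadline-offset-injective (sameDeadline _ _)
        (trans (elem-sat D x) (sym (elem-sat D y)))))))

mainTheorem10 : (n : ℕ) (G : Graph (Fin n)) (m k c : ℕ) →
    ColourableWithClustering G k c →
    ColourableWithClustering (G ⊠ Path m) (suc k) (c * k)
mainTheorem10 n G m zero    c (f , _)          = (λ _ → zero) , λ u _ _ _ → ¬Fin0 (f (proj₁ u))
mainTheorem10 n G m (suc k) c (f , clustered) = layered , layered-clustering clustered
  where open LayeredColouring G m (suc k) f
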